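{- Let $G$ and $H$ be connected non complete graphs and consider the corona product graph $G\circ H$. Let $i\in\{1,\ldots,n\}$ and let $h_1^i,h_2^i\in V(H^i)$ be arbitrary non adjacent vertices of the $i$-th copy $H^i$ of $H$. Then $WT_{G\circ H}(h_1^i,h_2^i)=V(G\circ H)\setminus X$, where $$X=\{x\in V(H^i): x\notin WT_{H^i}(h_1^i,h_2^i) \text{ and } x \text{ is adjacent to exactly one of } h_1^i \text{ and } h_2^i\}.$$
   Context: All graphs are finite, simple, connected and have at least two vertices. For vertices $u,v$ of a graph $G$, a weakly toll walk between $u$ and $v$ is a sequence $u=w_0,w_1,\ldots,w_k=v$ ($k\ge 0$) such that, when $k>0$: $w_iw_{i+1}\in E(G)$ for all $i\in\{0,\ldots,k-1\}$; $uw_i\in E(G)$ with $i\in\{1,\ldots,k\}$ implies $w_i=w_1$; and $w_iv\in E(G)$ with $i\in\{0,\ldots,k-1\}$ implies $w_i=w_{k-1}$. $WT_G(u,v)$ is the set of vertices lying on some weakly toll walk between $u$ and $v$. Let $V(G)=\{g_1,\ldots,g_n\}$ and $V(H)=\{h_1,\ldots,h_m\}$. The corona product $G\circ H$ consists of $G$ together with $n$ disjoint copies $H^1,\ldots,H^n$ of $H$, $V(H^i)=\{h_1^i,\ldots,h_m^i\}$, with additional edges $g_ih_j^i$ for all $i\in\{1,\ldots,n\}$, $j\in\{1,\ldots,m\}$. -}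

module Defs where

open import Data.Nat using (ℕ; zero; suc)
open import Data.Fin using (Fin; zero; suc; fromℕ; inject₁)
open import Data.Product using (Σ; ∃; _×_; _,_)
open import Data.Sum using (_⊎_; inj₁; inj₂)
open import Relation.Binary.PropositionalEquality using (_≡_)
open import Relation.Nullary using (¬_; Dec)

record Graph (n : ℕ) : Set₁ where
  field
    Adj    : Fin n → Fin n → Set
    adj?   : (a b : Fin n) → Dec (Adj a b)
    sym    : ∀ {a b} → Adj a b → Adj b a
    irrefl : ∀ {a} → ¬ Adj a a
open Graph public

IsWeaklyTollWalk : {V : Set} → (V → V → Set) → (k : ℕ) → (Fin (suc k) → V) → V → V → Set
IsWeaklyTollWalk Adj zero w u v = (w zero ≡ u) × (w zero ≡ v)
IsWeaklyTollWalk Adj (suc k) w u v =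
  (w zero ≡ u) × (w (fromℕ (suc k)) ≡ v)
  × ((j : Fin (suc k)) → Adj (w (inject₁ j)) (w (suc j)))
  × ((j : Fin (suc k)) → Adj u (w (suc j)) → w (suc j) ≡ w (suc zero))
  × ((j : Fin (suc k)) → Adj (w (inject₁ j)) v → w (inject₁ j) ≡ w (inject₁ (fromℕ k)))

WT : {V : Set} → (V → V → Set) → V → V → V → Set
WT {V} Adj u v x = ∃ λ k → ∃ λ (w : Fin (suc k) → V) →
  IsWeaklyTollWalk Adj k w u v × ∃ λ j → w j ≡ x

IsWalk : {V : Set} → (V → V → Set) → (k : ℕ) → (Fin (suc k) → V) → V → V → Set
IsWalk Adj k w u v = (w zero ≡ u) × (w (fromℕ k) ≡ v)
  × ((j : Fin k) → Adj (w (inject₁ j)) (w (suc j)))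

Connected : ∀ {n} → Graph n → Set
Connected {n} G = (u v : Fin n) → ∃ λ k → ∃ λ (w : Fin (suc k) → Fin n) → IsWalk (Adj G) k w u v

NonComplete : ∀ {n} → Graph n → Set
NonComplete {n} G = ∃ λ (a : Fin n) → ∃ λ (b : Fin n) → ¬ (a ≡ b) × ¬ Adj G a b

-- Vertices of the corona product G ∘ H: inj₁ g (vertex of G) or
-- inj₂ (i , h) (the copy h^i of h in H^i).
CVertex : ℕ → ℕ → Set
CVertex n m = Fin n ⊎ (Fin n × Fin m)

CoronaAdj : ∀ {n m} → Graph n → Graph m → CVertex n m → CVertex n m → Set
CoronaAdj G H (inj₁ a) (inj₁ b) = Adj G a b
CoronaAdj G H (inj₁ a) (inj₂ (i , y)) = a ≡ i
CoronaAdj G H (inj₂ (i , y)) (inj₁ a) = i ≡ a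
CoronaAdj G H (inj₂ (i , y)) (inj₂ (j , z)) = (i ≡ j) × Adj H y z

-- The exceptional set X for non-adjacent h₁, h₂ in copy i.
-- (WT_{H^i}(h₁^i,h₂^i) is the copy of WT_H(h₁,h₂).)
ExceptionalSet : ∀ {n m} → Graph m → Fin n → Fin m → Fin m → CVertex n m → Set
ExceptionalSet {n} {m} H i h₁ h₂ x = ∃ λ (y : Fin m) → (x ≡ inj₂ (i , y))
  × ¬ WT (Adj H) h₁ h₂ y
  × ((Adj H y h₁ × ¬ Adj H y h₂) ⊎ (¬ Adj H y h₁ × Adj H y h₂))

-- A weakly toll walk from u to v is the same thing as a walk from u to v on
-- which the only neighbour of u is some fixed a and the only neighbour of v is
-- some fixed b (a "guarded" walk).  In G ∘ H the vertex g_i is adjacent to both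
-- h₁^i and h₂^i, so if y^i is adjacent to exactly one of them, a guarded walk
-- through y^i cannot visit g_i; it therefore stays inside H^i and y ∈ WT_H.
-- Conversely every other vertex lies on a guarded walk: vertices of G and
-- vertices x ∈ H^j adjacent to neither h₁^i nor h₂^i by a detour
-- u → g_i ⇝ g_j ⇝ x ⇝ g_j ⇝ g_i → v through the connected graph G (guarded by
-- a = b = g_i), common neighbours of h₁ and h₂ on u → x → v, and vertices of
-- WT_H by lifting.  Since membership in X is a
-- negative condition, the last case needs WT_H to be decidable; it is, because
-- guarded walks are walks in a finite graph inside a decidable vertex set.
module Submission where

open import Defs
open import Data.Nat using (ℕ; zero; suc; _≤_; _<_; s≤s)
open import Data.Nat.Properties using (≤-refl; m≤n⇒m≤1+n; <⇒≤; <-≤-trans; ≤-pred; ≮⇒≥; n≮0; _<?_)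
open import Data.Fin using (Fin; zero; suc; fromℕ; inject₁)
open import Data.Fin.Properties using (any?; pigeonhole; _≟_)
open import Data.Fin.Induction using (<-weakInduction)
open import Data.Fin.Relation.Unary.Top using (view; ‵fromℕ; ‵inject₁)
open import Data.Product using (Σ; ∃; ∃₂; _×_; _,_; proj₁; proj₂)
open import Data.Sum using (_⊎_; inj₁; inj₂)
open import Data.Empty using (⊥-elim)
open import Function using (id; _∘_)
open import Relation.Nullary using (¬_; Dec; yes; no)
open import Relation.Nullary.Decidable using (_×-dec_; _⊎-dec_; _→-dec_; map′; decidable-stable)
open import Relation.Binary.PropositionalEquality as ≡ using (_≡_; _≢_; refl; trans; cong; subst; subst₂)

module Walks {V : Set} (A : V → V → Set) where

  data Walk : V → V → Set where
    nil  : ∀ x → Walk x x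
    cons : ∀ {y z} x → A x y → Walk y z → Walk x z

  length : ∀ {x z} → Walk x z → ℕ
  length (nil _)      = zero
  length (cons _ _ p) = suc (length p)

  vertex : ∀ {x z} (p : Walk x z) → Fin (suc (length p)) → V
  vertex (nil x)      zero    = x
  vertex (cons x _ _) zero    = x
  vertex (cons _ _ p) (suc t) = vertex p t

  vertex-last : ∀ {x z} (p : Walk x z) → vertex p (fromℕ (length p)) ≡ z
  vertex-last (nil _)      = refl
  vertex-last (cons _ _ p) = vertex-last p

  vertex-adjacent : ∀ {x z} (p : Walk x z) (j : Fin (length p)) →
                    A (vertex p (inject₁ j)) (vertex p (suc j))
  vertex-adjacent (cons _ e (nil _))      zero    = e
  vertex-adjacent (cons _ e (cons _ _ _)) zero    = e
  vertex-adjacent (cons _ _ p)            (suc j) = vertex-adjacent p j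

  fromVertices : ∀ {k} (w : Fin (suc k) → V) → (∀ j → A (w (inject₁ j)) (w (suc j))) →
                 Walk (w zero) (w (fromℕ k))
  fromVertices {zero}  w _   = nil (w zero)
  fromVertices {suc k} w adj = cons (w zero) (adj zero) (fromVertices (w ∘ suc) (adj ∘ suc))

  All : (V → Set) → ∀ {x z} → Walk x z → Set
  All P (nil x)      = P x
  All P (cons x _ p) = P x × All P p

  All-vertex : ∀ {P x z} (p : Walk x z) → All P p → ∀ t → P (vertex p t)
  All-vertex (nil _)      px         zero    = px
  All-vertex (cons _ _ _) (px , _)   zero    = px
  All-vertex (cons _ _ p) (_ , all)  (suc t) = All-vertex p all t

  All-fromVertices : ∀ {P k} (w : Fin (suc k) → V) adj → (∀ t → P (w t)) →
                     All P (fromVertices w adj)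
  All-fromVertices {k = zero}  w adj pw = pw zero
  All-fromVertices {k = suc k} w adj pw = pw zero , All-fromVertices (w ∘ suc) (adj ∘ suc) (pw ∘ suc)

  infix 4 _∈_
  _∈_ : ∀ {x z} → V → Walk x z → Set
  y ∈ nil x      = y ≡ x
  y ∈ cons x _ p = y ≡ x ⊎ y ∈ p

  source-∈ : ∀ {x z} (p : Walk x z) → x ∈ p
  source-∈ (nil _)      = refl
  source-∈ (cons _ _ _) = inj₁ refl

  ∈⇒vertex : ∀ {x z y} (p : Walk x z) → y ∈ p → ∃ λ t → vertex p t ≡ y
  ∈⇒vertex (nil _)      refl        = zero , refl
  ∈⇒vertex (cons _ _ _) (inj₁ refl) = zero , refl
  ∈⇒vertex (cons _ _ p) (inj₂ y∈p)  = let (t , eq) = ∈⇒vertex p y∈p in suc t , eq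

  vertex-∈-fromVertices : ∀ {k} (w : Fin (suc k) → V) adj t → w t ∈ fromVertices w adj
  vertex-∈-fromVertices {zero}  w adj zero    = refl
  vertex-∈-fromVertices {suc k} w adj zero    = inj₁ refl
  vertex-∈-fromVertices {suc k} w adj (suc t) = inj₂ (vertex-∈-fromVertices (w ∘ suc) (adj ∘ suc) t)

  infixr 5 _++_
  _++_ : ∀ {x y z} → Walk x y → Walk y z → Walk x z
  nil _      ++ q = q
  cons x e p ++ q = cons x e (p ++ q)

  All-++ : ∀ {P x y z} (p : Walk x y) {q : Walk y z} → All P p → All P q → All P (p ++ q)
  All-++ (nil _)      _          aq = aq
  All-++ (cons _ _ p) (px , ap)  aq = px , All-++ p ap aq

  ∈-++ʳ : ∀ {x y z w} (p : Walk x y) {q : Walk y z} → w ∈ q → w ∈ p ++ q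
  ∈-++ʳ (nil _)      w∈q = w∈q
  ∈-++ʳ (cons _ _ p) w∈q = inj₂ (∈-++ʳ p w∈q)

  WalkIn : (V → Set) → V → V → Set
  WalkIn P x z = Σ (Walk x z) (All P)

  stop : ∀ {P x} → P x → WalkIn P x x
  stop px = nil _ , px

  step : ∀ {P x y z} → P x → A x y → WalkIn P y z → WalkIn P x z
  step px e (p , ap) = cons _ e p , px , ap

  infixr 5 _++ᴾ_
  _++ᴾ_ : ∀ {P x y z} → WalkIn P x y → WalkIn P y z → WalkIn P x z
  (p , ap) ++ᴾ (q , aq) = p ++ q , All-++ p ap aq

  split-at : ∀ {P x z y} (p : Walk x z) → All P p → y ∈ p → WalkIn P x y × WalkIn P y z
  split-at (nil x)      ap         refl        = stop ap , stop ap
  split-at (cons x e p) (px , ap)  (inj₁ refl) = stop px , (cons x e p , px , ap)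
  split-at (cons x e p) (px , ap)  (inj₂ y∈p)  =
    let (before , after) = split-at p ap y∈p in step px e before , after

module _ {V U : Set} {A : V → V → Set} {B : U → U → Set}
         (f : V → U) (f-preserves : ∀ {a b} → A a b → B (f a) (f b)) where
  open Walks

  map-walk : ∀ {x z} → Walk A x z → Walk B (f x) (f z)
  map-walk (nil x)      = nil (f x)
  map-walk (cons x e p) = cons (f x) (f-preserves e) (map-walk p)

  All-map-walk : ∀ {P : U → Set} → (∀ a → P (f a)) → ∀ {x z} (p : Walk A x z) → All B P (map-walk p)
  All-map-walk pf (nil x)      = pf x
  All-map-walk pf (cons x _ p) = pf x , All-map-walk pf p

-- By pigeonhole a walk inside P shortens to fewer than m steps, so a bounded
-- search decides reachability inside P.
module Reachability {m : ℕ} (A : Fin m → Fin m → Set) (A? : ∀ a b → Dec (A a b))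
                    (P : Fin m → Set) (P? : ∀ x → Dec (P x)) where
  open Walks A

  ReachableWithin : ℕ → Fin m → Fin m → Set
  ReachableWithin zero    x z = P x × x ≡ z
  ReachableWithin (suc n) x z = P x × (x ≡ z ⊎ ∃ λ c → A x c × ReachableWithin n c z)

  reachableWithin? : ∀ n x z → Dec (ReachableWithin n x z)
  reachableWithin? zero    x z = P? x ×-dec x ≟ z
  reachableWithin? (suc n) x z =
    P? x ×-dec (x ≟ z ⊎-dec any? λ c → A? x c ×-dec reachableWithin? n c z)

  within⇒walk : ∀ n {x z} → ReachableWithin n x z → WalkIn P x z
  within⇒walk zero    (px , refl)             = stop px
  within⇒walk (suc n) (px , inj₁ refl)        = stop px
  within⇒walk (suc n) (px , inj₂ (_ , e , r)) = step px e (within⇒walk n r)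

  walk⇒within : ∀ n {x z} (p : Walk x z) → All P p → length p ≤ n → ReachableWithin n x z
  walk⇒within zero    (nil _)      px        _         = px , refl
  walk⇒within (suc n) (nil _)      px        _         = px , inj₁ refl
  walk⇒within (suc n) (cons _ e p) (px , ap) (s≤s p≤n) = px , inj₂ (_ , e , walk⇒within n p ap p≤n)

  suffix : ∀ {y z} (p : Walk y z) (t : Fin (suc (length p))) {s} → s ≡ vertex p t →
           Σ (Walk s z) λ q → length q ≤ length p × (All P p → All P q)
  suffix (nil y)      zero    refl = nil y , ≤-refl , id
  suffix (cons y e p) zero    refl = cons y e p , ≤-refl , id
  suffix (cons y e p) (suc t) s≡pt =
    let (q , q≤p , keep) = suffix p t s≡pt in q , m≤n⇒m≤1+n q≤p , keep ∘ proj₂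

  shortcut : ∀ {x z} (p : Walk x z) (s t : Fin (suc (length p))) → s Data.Fin.< t →
             vertex p s ≡ vertex p t → Σ (Walk x z) λ q → length q < length p × (All P p → All P q)
  shortcut (cons x e p) zero    (suc t) _         same =
    let (q , q≤p , keep) = suffix p t same in q , s≤s q≤p , keep ∘ proj₂
  shortcut (cons x e p) (suc s) (suc t) (s≤s s<t) same =
    let (q , q<p , keep) = shortcut p s t s<t same
    in cons x e q , s≤s q<p , λ (px , ap) → px , keep ap

  shorten : ∀ n {x z} (p : Walk x z) → All P p → length p ≤ n →
            Σ (Walk x z) λ q → All P q × length q < m
  shorten n p ap p≤n with length p <? m
  ... | yes p<m = p , ap , p<m
  ... | no  p≮m with pigeonhole (s≤s (≮⇒≥ p≮m)) (vertex p)
  ... | s , t , s<t , same with shortcut p s t s<t same | n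
  ... | q , q<p , keep | zero  = ⊥-elim (n≮0 (<-≤-trans q<p p≤n))
  ... | q , q<p , keep | suc n = shorten n q (keep ap) (≤-pred (<-≤-trans q<p p≤n))

  reachable? : ∀ x z → Dec (WalkIn P x z)
  reachable? x z = map′ (within⇒walk m) short (reachableWithin? m x z)
    where
    short : WalkIn P x z → ReachableWithin m x z
    short (p , ap) = let (q , aq , q<m) = shorten (length p) p ap ≤-refl
                     in walk⇒within m q aq (<⇒≤ q<m)

module Toll {V : Set} (A : V → V → Set) where
  open Walks A

  Guarded : V → V → V → V → V → Set
  Guarded u v a b z = (A u z → z ≡ a) × (A z v → z ≡ b)

  ThroughGuarded : V → V → V → Set
  ThroughGuarded u v y = ∃₂ λ a b → WalkIn (Guarded u v a b) u y × WalkIn (Guarded u v a b) y v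

  source-guarded : ∀ {u v a b} → ¬ A u u → ¬ A u v → Guarded u v a b u
  source-guarded u≁u u≁v = ⊥-elim ∘ u≁u , ⊥-elim ∘ u≁v

  target-guarded : ∀ {u v a b} → ¬ A v v → ¬ A u v → Guarded u v a b v
  target-guarded v≁v u≁v = ⊥-elim ∘ u≁v , ⊥-elim ∘ v≁v

  nonadjacent-guarded : ∀ {u v a b z} → ¬ A u z → ¬ A z v → Guarded u v a b z
  nonadjacent-guarded u≁z z≁v = ⊥-elim ∘ u≁z , ⊥-elim ∘ z≁v

  source-neighbour-is-second : ∀ {k u v w} → IsWeaklyTollWalk A (suc k) w u v → ¬ A u u →
                               ∀ s → A u (w s) → w s ≡ w (suc zero)
  source-neighbour-is-second {u = u} (w0≡u , _) u≁u zero u~w = ⊥-elim (u≁u (subst (A u) w0≡u u~w))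
  source-neighbour-is-second (_ , _ , _ , src , _) _ (suc s) u~w = src s u~w

  target-neighbour-is-penultimate : ∀ {k u v w} → IsWeaklyTollWalk A (suc k) w u v → ¬ A v v →
                                    ∀ s → A (w s) v → w s ≡ w (inject₁ (fromℕ k))
  target-neighbour-is-penultimate {v = v} (_ , wk≡v , _ , _ , tgt) v≁v s w~v with view s
  ... | ‵fromℕ     = ⊥-elim (v≁v (subst (λ z → A z v) wk≡v w~v))
  ... | ‵inject₁ j = tgt j w~v

  source-neighbours-agree : ∀ {k u v w} → IsWeaklyTollWalk A (suc k) w u v → ¬ A u u →
                            ∀ s t {a b} → w s ≡ a → w t ≡ b → A u a → A u b → a ≡ b
  source-neighbours-agree toll u≁u s t refl refl u~a u~b =
    trans (source-neighbour-is-second toll u≁u s u~a) (≡.sym (source-neighbour-is-second toll u≁u t u~b))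

  target-neighbours-agree : ∀ {k u v w} → IsWeaklyTollWalk A (suc k) w u v → ¬ A v v →
                            ∀ s t {a b} → w s ≡ a → w t ≡ b → A a v → A b v → a ≡ b
  target-neighbours-agree toll v≁v s t refl refl a~v b~v =
    trans (target-neighbour-is-penultimate toll v≁v s a~v)
          (≡.sym (target-neighbour-is-penultimate toll v≁v t b~v))

  guarded-walk⇒WT : ∀ {u v a b y} → u ≢ v → (p : Walk u v) → All (Guarded u v a b) p → y ∈ p → WT A u v y
  guarded-walk⇒WT u≢v (nil _) _ _ = ⊥-elim (u≢v refl)
  guarded-walk⇒WT {u} {v} {a} {b} u≢v p@(cons _ _ q) ap y∈p =
    length p , vertex p , (refl , vertex-last q , vertex-adjacent p , to-second , to-penultimate) , ∈⇒vertex p y∈p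
    where
    guarded : ∀ t → Guarded u v a b (vertex p t)
    guarded = All-vertex p ap

    penultimate : Fin (suc (length p))
    penultimate = inject₁ (fromℕ (length q))

    to-second : ∀ j → A u (vertex p (suc j)) → vertex p (suc j) ≡ vertex p (suc zero)
    to-second j u~w = trans (proj₁ (guarded (suc j)) u~w)
                            (≡.sym (proj₁ (guarded (suc zero)) (vertex-adjacent p zero)))

    to-penultimate : ∀ j → A (vertex p (inject₁ j)) v → vertex p (inject₁ j) ≡ vertex p penultimate
    to-penultimate j w~v = trans (proj₂ (guarded (inject₁ j)) w~v) (≡.sym (proj₂ (guarded penultimate)
      (subst (A (vertex p penultimate)) (vertex-last q) (vertex-adjacent p (fromℕ (length q))))))

  through⇒WT : ∀ {u v y} → u ≢ v → ThroughGuarded u v y → WT A u v y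
  through⇒WT u≢v (_ , _ , (p , ap) , (q , aq)) = guarded-walk⇒WT u≢v (p ++ q) (All-++ p ap aq) (∈-++ʳ p (source-∈ q))

  WT⇒through : ∀ {u v y} → (∀ {x} → ¬ A x x) → u ≢ v → WT A u v y → ThroughGuarded u v y
  WT⇒through _ u≢v (zero , w , (w0≡u , w0≡v) , _) = ⊥-elim (u≢v (trans (≡.sym w0≡u) w0≡v))
  WT⇒through irrefl _ (suc k , w , toll@(refl , refl , adj , _) , t , refl) =
    w (suc zero) , w (inject₁ (fromℕ k)) ,
    split-at (fromVertices w adj) (All-fromVertices w adj guarded) (vertex-∈-fromVertices w adj t)
    where
    guarded : ∀ s → Guarded (w zero) (w (fromℕ (suc k))) (w (suc zero)) (w (inject₁ (fromℕ k))) (w s)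
    guarded s = source-neighbour-is-second toll irrefl s , target-neighbour-is-penultimate toll irrefl s

wt? : ∀ {m} (H : Graph m) {u v} → u ≢ v → ∀ y → Dec (WT (Adj H) u v y)
wt? H {u} {v} u≢v y = map′ (through⇒WT u≢v) (WT⇒through (irrefl H) u≢v) through?
  where
  open Toll (Adj H)
  guarded? : ∀ a b z → Dec (Guarded u v a b z)
  guarded? a b z = (adj? H u z →-dec z ≟ a) ×-dec (adj? H z v →-dec z ≟ b)
  through? : Dec (ThroughGuarded u v y)
  through? = any? λ a → any? λ b →
    let open Reachability (Adj H) (adj? H) (Guarded u v a b) (guarded? a b)
    in reachable? u y ×-dec reachable? y v

module _ {V U : Set} {A : V → V → Set} {B : U → U → Set} (f : V → U)
         (f-preserves : ∀ {a b} → A a b → B (f a) (f b))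
         (f-reflects : ∀ {a b} → B (f a) (f b) → A a b) where

  toll-walk-image : ∀ k {w u v} → IsWeaklyTollWalk A k w u v → IsWeaklyTollWalk B k (f ∘ w) (f u) (f v)
  toll-walk-image zero    (w0≡u , w0≡v) = cong f w0≡u , cong f w0≡v
  toll-walk-image (suc k) (w0≡u , wk≡v , adj , src , tgt) =
    cong f w0≡u , cong f wk≡v , f-preserves ∘ adj ,
    (λ j h → cong f (src j (f-reflects h))) , (λ j h → cong f (tgt j (f-reflects h)))

  toll-walk-preimage : (∀ {a b} → f a ≡ f b → a ≡ b) →
                       ∀ k {w w′ u v} → (∀ t → f (w t) ≡ w′ t) →
                       IsWeaklyTollWalk B k w′ (f u) (f v) → IsWeaklyTollWalk A k w u v
  toll-walk-preimage f-injective zero {w} image (w0≡u , w0≡v) =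
    f-injective (trans (image zero) w0≡u) , f-injective (trans (image zero) w0≡v)
  toll-walk-preimage f-injective (suc k) {w} {w′} {u} {v} image (w0≡u , wk≡v , adj , src , tgt) =
    f-injective (trans (image _) w0≡u) , f-injective (trans (image _) wk≡v) ,
    (λ j → f-reflects (subst₂ B (≡.sym (image _)) (≡.sym (image _)) (adj j))) ,
    (λ j h → pull (src j (subst (B (f u)) (image _) (f-preserves h)))) ,
    (λ j h → pull (tgt j (subst (λ z → B z (f v)) (image _) (f-preserves h))))
    where
    pull : ∀ {s t} → w′ s ≡ w′ t → w s ≡ w t
    pull {s} {t} same = f-injective (trans (image s) (trans same (≡.sym (image t))))

module Corona {n m} (G : Graph n) (H : Graph m) where
  open Walks (CoronaAdj G H)
  open Toll (CoronaAdj G H)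

  CA : CVertex n m → CVertex n m → Set
  CA = CoronaAdj G H

  corona-irrefl : ∀ {x} → ¬ CA x x
  corona-irrefl {inj₁ _} = irrefl G
  corona-irrefl {inj₂ _} = irrefl H ∘ proj₂

  corona-adj? : ∀ x y → Dec (CA x y)
  corona-adj? (inj₁ a)       (inj₁ b)       = adj? G a b
  corona-adj? (inj₁ a)       (inj₂ (j , _)) = a ≟ j
  corona-adj? (inj₂ (j , _)) (inj₁ b)       = j ≟ b
  corona-adj? (inj₂ (j , y)) (inj₂ (l , z)) = j ≟ l ×-dec adj? H y z

  module _ (i : Fin n) where

    hub : CVertex n m
    hub = inj₁ i

    copy : Fin m → CVertex n m
    copy y = inj₂ (i , y)

    copy-injective : ∀ {y z} → copy y ≡ copy z → y ≡ z
    copy-injective refl = refl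

    copy≢hub : ∀ {y} → copy y ≢ hub
    copy≢hub ()

    InCopy : CVertex n m → Set
    InCopy x = ∃ λ y → copy y ≡ x

    neighbour-in-copy : ∀ {x} z → InCopy x → CA x z → z ≢ hub → InCopy z
    neighbour-in-copy (inj₁ _)       (_ , refl) i≡g      z≢hub = ⊥-elim (z≢hub (cong inj₁ (≡.sym i≡g)))
    neighbour-in-copy (inj₂ (_ , z)) (_ , refl) (refl , _) _   = z , refl

    stays-in-copy : ∀ {k} (w : Fin (suc k) → CVertex n m) → InCopy (w zero) →
                    (∀ j → CA (w (inject₁ j)) (w (suc j))) → (∀ s → w s ≢ hub) → ∀ s → InCopy (w s)
    stays-in-copy w start adj avoids =
      <-weakInduction (InCopy ∘ w) start λ j inCopy → neighbour-in-copy (w (suc j)) inCopy (adj j) (avoids (suc j))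

    module _ (h₁ h₂ : Fin m) (h₁≢h₂ : h₁ ≢ h₂) (h₁≁h₂ : ¬ Adj H h₁ h₂) where

      u v : CVertex n m
      u = copy h₁
      v = copy h₂

      u≢v : u ≢ v
      u≢v = h₁≢h₂ ∘ copy-injective

      u≁v : ¬ CA u v
      u≁v = h₁≁h₂ ∘ proj₂

      u-guarded : ∀ {a b} → Guarded u v a b u
      u-guarded = source-guarded {u = u} {v = v} (corona-irrefl {u}) u≁v

      v-guarded : ∀ {a b} → Guarded u v a b v
      v-guarded = target-guarded {u = u} {v = v} (corona-irrefl {v}) u≁v

      -- y^i and g_i would be two distinct neighbours of h₁^i (or of h₂^i) on
      -- the walk, which the toll conditions forbid.
      one-sided⇒avoids-hub : ∀ {k w t y} → IsWeaklyTollWalk CA (suc k) w u v → w t ≡ copy y →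
                             (Adj H y h₁ × ¬ Adj H y h₂) ⊎ (¬ Adj H y h₁ × Adj H y h₂) →
                             ∀ s → w s ≢ hub
      one-sided⇒avoids-hub {t = t} toll wt≡y (inj₁ (y~h₁ , _)) s ws≡hub =
        copy≢hub (source-neighbours-agree toll (corona-irrefl {u}) t s wt≡y ws≡hub (refl , sym H y~h₁) refl)
      one-sided⇒avoids-hub {t = t} toll wt≡y (inj₂ (_ , y~h₂)) s ws≡hub =
        copy≢hub (target-neighbours-agree toll (corona-irrefl {v}) t s wt≡y ws≡hub (refl , y~h₂) refl)

      WT⇒¬exceptional : ∀ x → WT CA u v x → ¬ ExceptionalSet H i h₁ h₂ x
      WT⇒¬exceptional _ (zero , w , (w0≡u , w0≡v) , _) _ = u≢v (trans (≡.sym w0≡u) w0≡v)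
      WT⇒¬exceptional _ (suc k , w , toll@(w0≡u , _ , adj , _) , t , wt≡x) (y , refl , y∉WT , one-sided) =
        y∉WT (suc k , proj₁ ∘ in-copy , projected-toll , t , copy-injective (trans (proj₂ (in-copy t)) wt≡x))
        where
        in-copy : ∀ s → InCopy (w s)
        in-copy = stays-in-copy w (h₁ , ≡.sym w0≡u) adj (one-sided⇒avoids-hub toll wt≡x one-sided)

        projected-toll : IsWeaklyTollWalk (Adj H) (suc k) (proj₁ ∘ in-copy) h₁ h₂
        projected-toll =
          toll-walk-preimage {A = Adj H} {B = CA} copy (refl ,_) proj₂ copy-injective (suc k) (proj₂ ∘ in-copy) toll

      WT-copy : ∀ {y} → WT (Adj H) h₁ h₂ y → WT CA u v (copy y)
      WT-copy (k , w , toll , t , wt≡y) =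
        k , copy ∘ w , toll-walk-image {A = Adj H} {B = CA} copy (refl ,_) proj₂ k toll , t , cong copy wt≡y

      module _ (G-connected : Connected G) where

        HubGuarded : CVertex n m → Set
        HubGuarded = Guarded u v hub hub

        hub-guarded : ∀ g → HubGuarded (inj₁ g)
        hub-guarded g = (λ i≡g → cong inj₁ (≡.sym i≡g)) , cong inj₁

        lift : ∀ {a b} → Walks.Walk (Adj G) a b → WalkIn HubGuarded (inj₁ a) (inj₁ b)
        lift p = map-walk {A = Adj G} {B = CA} inj₁ id p , All-map-walk {A = Adj G} {B = CA} inj₁ id hub-guarded p

        path : ∀ a b → WalkIn HubGuarded (inj₁ a) (inj₁ b)
        path a b with G-connected a b
        ... | _ , w , refl , refl , adj = lift (Walks.fromVertices (Adj G) w adj)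

        via-hub : ∀ g {x} → WalkIn HubGuarded (inj₁ g) x → WalkIn HubGuarded x (inj₁ g) → WT CA u v x
        via-hub g to from = through⇒WT u≢v (hub , hub ,
          step u-guarded refl (path i g ++ᴾ to) ,
          from ++ᴾ path g i ++ᴾ step (hub-guarded i) refl (stop v-guarded))

        ¬exceptional⇒WT : ∀ x → ¬ ExceptionalSet H i h₁ h₂ x → WT CA u v x
        ¬exceptional⇒WT (inj₁ g) _ = via-hub g (stop (hub-guarded g)) (stop (hub-guarded g))
        ¬exceptional⇒WT x@(inj₂ (j , y)) x∉X with corona-adj? u x | corona-adj? x v
        ... | no u≁x | no x≁v =
          via-hub j (step (hub-guarded j) refl (stop x-guarded)) (step x-guarded refl (stop (hub-guarded j)))
          where
          x-guarded : HubGuarded x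
          x-guarded = nonadjacent-guarded {u = u} {v = v} u≁x x≁v
        ... | yes u~x | yes x~v =
          through⇒WT u≢v (x , x , step u-guarded u~x (stop x-guarded) ,
                                  step x-guarded x~v (stop v-guarded))
          where
          x-guarded : Guarded u v x x x
          x-guarded = (λ _ → refl) , (λ _ → refl)
        ... | yes (refl , h₁~y) | no x≁v = WT-copy (decidable-stable (wt? H h₁≢h₂ y)
          λ y∉WT → x∉X (y , refl , y∉WT , inj₁ (sym H h₁~y , x≁v ∘ (refl ,_))))
        ... | no u≁x | yes (refl , y~h₂) = WT-copy (decidable-stable (wt? H h₁≢h₂ y)
          λ y∉WT → x∉X (y , refl , y∉WT , inj₂ (u≁x ∘ (refl ,_) ∘ sym H , y~h₂)))

mainTheorem13 : ∀ {n m} (G : Graph n) (H : Graph m)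
    → Connected G → NonComplete G → Connected H → NonComplete H
    → (i : Fin n) (h₁ h₂ : Fin m) → ¬ (h₁ ≡ h₂) → ¬ Adj H h₁ h₂
    → (x : CVertex n m)
    → (WT (CoronaAdj G H) (inj₂ (i , h₁)) (inj₂ (i , h₂)) x → ¬ ExceptionalSet H i h₁ h₂ x)
    × (¬ ExceptionalSet H i h₁ h₂ x → WT (CoronaAdj G H) (inj₂ (i , h₁)) (inj₂ (i , h₂)) x)
mainTheorem13 G H G-connected _ _ _ i h₁ h₂ h₁≢h₂ h₁≁h₂ x =
  WT⇒¬exceptional i h₁ h₂ h₁≢h₂ h₁≁h₂ x , ¬exceptional⇒WT i h₁ h₂ h₁≢h₂ h₁≁h₂ G-connected x
  where open Corona G H
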